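{- Let $\xi$ be an all-small position with $\xi\neq 0$. Then $*+*\equiv 0\pmod{\mathrm{cl}(\xi)}$.
   Context: A position $\xi=\{\xi^L \mid \xi^R\}$ is given recursively by finite sets of Left and Right options; $0=\{\cdot\mid\cdot\}$, $*=\{0\mid 0\}$. A position is all-small if Left can move in it iff Right can, and every option is all-small. Disjunctive sum: $\alpha+\beta=\{\alpha^L+\beta,\alpha+\beta^L \mid \alpha^R+\beta,\alpha+\beta^R\}$. Under misère play a player unable to move on their turn wins; $o^-(\xi)\in\{\mathcal{L},\mathcal{R},\mathcal{N},\mathcal{P}\}$ is the misère outcome (Left wins always / Right wins always / next player wins / next player loses). $\mathrm{cl}(\Upsilon)$ is the smallest set containing $\Upsilon$ closed under disjunctive sum and taking options. For a closed set $\Gamma$ and $\alpha,\beta\in\Gamma$, $\alpha\equiv\beta\pmod\Gamma$ means $o^-(\alpha+\gamma)=o^-(\beta+\gamma)$ for all $\gamma\in\Gamma$. -}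

module Defs where

open import Data.List using (List; []; _∷_)
open import Data.List.Relation.Unary.All using (All)
open import Data.List.Membership.Propositional using (_∈_)
open import Data.Bool using (Bool; true; false; not; _∨_)
open import Data.Product using (_×_)
open import Relation.Nullary using (¬_)
open import Relation.Binary.PropositionalEquality using (_≡_)

data Game : Set where
  ⟨_∣_⟩ : List Game → List Game → Game

leftOpts : Game → List Game
leftOpts ⟨ L ∣ _ ⟩ = L

rightOpts : Game → List Game
rightOpts ⟨ _ ∣ R ⟩ = R

𝟘 : Game
𝟘 = ⟨ [] ∣ [] ⟩

⋆ : Game
⋆ = ⟨ 𝟘 ∷ [] ∣ 𝟘 ∷ [] ⟩

infixl 6 _+_
mutual
  _+_ : Game → Game → Game
  α@(⟨ αL ∣ αR ⟩) + β@(⟨ βL ∣ βR ⟩) =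
    ⟨ app (mapL αL β) (mapR α βL) ∣ app (mapL αR β) (mapR α βR) ⟩

  mapL : List Game → Game → List Game
  mapL [] β = []
  mapL (a ∷ as) β = (a + β) ∷ mapL as β

  mapR : Game → List Game → List Game
  mapR α [] = []
  mapR α (b ∷ bs) = (α + b) ∷ mapR α bs

  app : List Game → List Game → List Game
  app [] ys = ys
  app (x ∷ xs) ys = x ∷ app xs ys

-- Misère play: a player unable to move on their turn wins.
mutual
  leftWinsFirst : Game → Bool
  leftWinsFirst ⟨ [] ∣ R ⟩ = true
  leftWinsFirst ⟨ g ∷ L ∣ R ⟩ = someLeftGood (g ∷ L)

  someLeftGood : List Game → Bool
  someLeftGood [] = false
  someLeftGood (g ∷ gs) = not (rightWinsFirst g) ∨ someLeftGood gs

  rightWinsFirst : Game → Bool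
  rightWinsFirst ⟨ L ∣ [] ⟩ = true
  rightWinsFirst ⟨ L ∣ g ∷ R ⟩ = someRightGood (g ∷ R)

  someRightGood : List Game → Bool
  someRightGood [] = false
  someRightGood (g ∷ gs) = not (leftWinsFirst g) ∨ someRightGood gs

data Outcome : Set where
  𝓛 𝓡 𝓝 𝓟 : Outcome

outcomeOf : Bool → Bool → Outcome
outcomeOf true  false = 𝓛
outcomeOf false true  = 𝓡
outcomeOf true  true  = 𝓝
outcomeOf false false = 𝓟

o⁻ : Game → Outcome
o⁻ g = outcomeOf (leftWinsFirst g) (rightWinsFirst g)

data AllSmall : Game → Set where
  allSmall : ∀ {L R} →
    (¬ L ≡ [] → ¬ R ≡ []) → (¬ R ≡ [] → ¬ L ≡ []) →
    All AllSmall L → All AllSmall R → AllSmall ⟨ L ∣ R ⟩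

data Cl (ξ : Game) : Game → Set where
  base : Cl ξ ξ
  sum  : ∀ {α β} → Cl ξ α → Cl ξ β → Cl ξ (α + β)
  optL : ∀ {α g} → Cl ξ α → g ∈ leftOpts α → Cl ξ g
  optR : ∀ {α g} → Cl ξ α → g ∈ rightOpts α → Cl ξ g

_≡_mod-cl_ : Game → Game → Game → Set
α ≡ β mod-cl ξ = ∀ γ → Cl ξ γ → o⁻ (α + γ) ≡ o⁻ (β + γ)

module Submission where

-- In ⋆ + ⋆ + γ both of Left's moves in ⋆ + ⋆ lead to ⋆ + γ
-- (as 𝟘 + ⋆ and ⋆ + 𝟘 both compute to ⋆), and Right can answer by moving
-- ⋆ to 𝟘, returning to γ with Left to move.  So Left's move in ⋆ + ⋆ can
-- only win when Left already wins γ moving first; but if γ is all-small and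
-- nonzero, Left then also has a move in γ, and by induction her moves
-- γᴸ ↦ ⋆ + ⋆ + γᴸ win exactly when γᴸ does.  Hence ⋆ + ⋆ + γ has the same
-- misère outcome as γ for every all-small γ (symmetrically for Right).
--
-- The theorem
-- combines the three.

open import Defs
open import Relation.Nullary using (¬_)
open import Relation.Binary.PropositionalEquality
  using (_≡_; refl; sym; trans; cong; cong₂; module ≡-Reasoning)
open import Data.List using (List; []; _∷_)
open import Data.List.Relation.Unary.All using (All; []; _∷_; lookup)
open import Data.Bool using (true; false; not; _∨_)
open import Data.Empty using (⊥-elim)
open import Data.Product using (_×_; _,_)

-- In an all-small position one option list is empty iff the other is;
-- this turns the "nonempty implies nonempty" hypotheses into "empty implies empty".
empty-transfer : ∀ {L R : List Game} → (¬ L ≡ [] → ¬ R ≡ []) → R ≡ [] → L ≡ []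
empty-transfer {[]}    _ _     = refl
empty-transfer {_ ∷ _} f R≡[] = ⊥-elim (f (λ ()) R≡[])

sumOptions-empty : ∀ {α β} xs ys → app (mapL xs β) (mapR α ys) ≡ [] → xs ≡ [] × ys ≡ []
sumOptions-empty []      []      _  = refl , refl
sumOptions-empty []      (_ ∷ _) ()
sumOptions-empty (_ ∷ _) _       ()

sumOptions-nil : ∀ {α β} {xs ys : List Game} → xs ≡ [] → ys ≡ [] →
                 app (mapL xs β) (mapR α ys) ≡ []
sumOptions-nil refl refl = refl

All-app : ∀ {P : Game → Set} {xs ys} → All P xs → All P ys → All P (app xs ys)
All-app []       qs = qs
All-app (p ∷ ps) qs = p ∷ All-app ps qs

mutual
  allSmall-+ : ∀ {α β} → AllSmall α → AllSmall β → AllSmall (α + β)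
  allSmall-+ {⟨ αL ∣ αR ⟩} {⟨ βL ∣ βR ⟩}
             pα@(allSmall Lα→Rα Rα→Lα allL-α allR-α)
             pβ@(allSmall Lβ→Rβ Rβ→Lβ allL-β allR-β) =
    allSmall
      (λ L≢[] R≡[] → let (αR≡[] , βR≡[]) = sumOptions-empty αR βR R≡[] in
         L≢[] (sumOptions-nil (empty-transfer Lα→Rα αR≡[]) (empty-transfer Lβ→Rβ βR≡[])))
      (λ R≢[] L≡[] → let (αL≡[] , βL≡[]) = sumOptions-empty αL βL L≡[] in
         R≢[] (sumOptions-nil (empty-transfer Rα→Lα αL≡[]) (empty-transfer Rβ→Lβ βL≡[])))
      (All-app (allSmall-mapL allL-α pβ) (allSmall-mapR pα allL-β))
      (All-app (allSmall-mapL allR-α pβ) (allSmall-mapR pα allR-β))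

  allSmall-mapL : ∀ {as β} → All AllSmall as → AllSmall β → All AllSmall (mapL as β)
  allSmall-mapL []       _  = []
  allSmall-mapL (p ∷ ps) pβ = allSmall-+ p pβ ∷ allSmall-mapL ps pβ

  allSmall-mapR : ∀ {α bs} → AllSmall α → All AllSmall bs → All AllSmall (mapR α bs)
  allSmall-mapR _  []       = []
  allSmall-mapR pα (p ∷ ps) = allSmall-+ pα p ∷ allSmall-mapR pα ps

closure-allSmall : ∀ {ξ γ} → AllSmall ξ → Cl ξ γ → AllSmall γ
closure-allSmall pξ base      = pξ
closure-allSmall pξ (sum c d) = allSmall-+ (closure-allSmall pξ c) (closure-allSmall pξ d)
closure-allSmall pξ (optL c g∈L) with closure-allSmall pξ c
... | allSmall _ _ allL _ = lookup allL g∈L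
closure-allSmall pξ (optR c g∈R) with closure-allSmall pξ c
... | allSmall _ _ _ allR = lookup allR g∈R

mutual
  𝟘-+-identity : ∀ g → 𝟘 + g ≡ g
  𝟘-+-identity ⟨ L ∣ R ⟩ = cong₂ ⟨_∣_⟩ (𝟘-mapR-identity L) (𝟘-mapR-identity R)

  𝟘-mapR-identity : ∀ gs → mapR 𝟘 gs ≡ gs
  𝟘-mapR-identity []       = refl
  𝟘-mapR-identity (g ∷ gs) = cong₂ _∷_ (𝟘-+-identity g) (𝟘-mapR-identity gs)

-- The Boolean core of the reversibility argument.  Left's two moves in
-- ⋆ + ⋆ both reach ⋆ + γ, which wins iff not (not a ∨ x), where a says
-- Left wins γ moving first (after Right's reply ⋆ ↦ 𝟘) and x covers
-- Right's other replies.  That move is redundant when a already forces a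
-- winning option among the remaining ones, s.
reversible-move-redundant : ∀ a x s → (a ≡ true → s ≡ true) →
  (not (not a ∨ x) ∨ (not (not a ∨ x) ∨ s)) ≡ s
reversible-move-redundant false _     _ _    = refl
reversible-move-redundant true  true  _ _    = refl
reversible-move-redundant true  false _ a→s = sym (a→s refl)

mutual
  ⋆⋆-leftWinsFirst : ∀ {γ} → AllSmall γ → leftWinsFirst (⋆ + ⋆ + γ) ≡ leftWinsFirst γ
  ⋆⋆-leftWinsFirst (allSmall {[]} {[]}    _ _ _ _) = refl
  ⋆⋆-leftWinsFirst (allSmall {[]} {_ ∷ _} _ R→L _ _) = ⊥-elim (R→L (λ ()) refl)
  ⋆⋆-leftWinsFirst {γ} (allSmall {x ∷ xs} {R} _ _ allL _) =
    trans (reversible-move-redundant (leftWinsFirst (𝟘 + γ)) (someRightGood (mapR ⋆ R))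
             (someLeftGood (mapR (⋆ + ⋆) (x ∷ xs))) Left-wins-γ→s)
          ih
    where
    ih : someLeftGood (mapR (⋆ + ⋆) (x ∷ xs)) ≡ someLeftGood (x ∷ xs)
    ih = ⋆⋆-someLeftGood allL
    Left-wins-γ→s : leftWinsFirst (𝟘 + γ) ≡ true → someLeftGood (mapR (⋆ + ⋆) (x ∷ xs)) ≡ true
    Left-wins-γ→s e = trans ih (trans (cong leftWinsFirst (sym (𝟘-+-identity γ))) e)

  ⋆⋆-rightWinsFirst : ∀ {γ} → AllSmall γ → rightWinsFirst (⋆ + ⋆ + γ) ≡ rightWinsFirst γ
  ⋆⋆-rightWinsFirst (allSmall {[]}    {[]} _ _ _ _) = refl
  ⋆⋆-rightWinsFirst (allSmall {_ ∷ _} {[]} L→R _ _ _) = ⊥-elim (L→R (λ ()) refl)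
  ⋆⋆-rightWinsFirst {γ} (allSmall {L} {y ∷ ys} _ _ _ allR) =
    trans (reversible-move-redundant (rightWinsFirst (𝟘 + γ)) (someLeftGood (mapR ⋆ L))
             (someRightGood (mapR (⋆ + ⋆) (y ∷ ys))) Right-wins-γ→s)
          ih
    where
    ih : someRightGood (mapR (⋆ + ⋆) (y ∷ ys)) ≡ someRightGood (y ∷ ys)
    ih = ⋆⋆-someRightGood allR
    Right-wins-γ→s : rightWinsFirst (𝟘 + γ) ≡ true → someRightGood (mapR (⋆ + ⋆) (y ∷ ys)) ≡ true
    Right-wins-γ→s e = trans ih (trans (cong rightWinsFirst (sym (𝟘-+-identity γ))) e)

  ⋆⋆-someLeftGood : ∀ {gs} → All AllSmall gs → someLeftGood (mapR (⋆ + ⋆) gs) ≡ someLeftGood gs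
  ⋆⋆-someLeftGood []       = refl
  ⋆⋆-someLeftGood (p ∷ ps) = cong₂ _∨_ (cong not (⋆⋆-rightWinsFirst p)) (⋆⋆-someLeftGood ps)

  ⋆⋆-someRightGood : ∀ {gs} → All AllSmall gs → someRightGood (mapR (⋆ + ⋆) gs) ≡ someRightGood gs
  ⋆⋆-someRightGood []       = refl
  ⋆⋆-someRightGood (p ∷ ps) = cong₂ _∨_ (cong not (⋆⋆-leftWinsFirst p)) (⋆⋆-someRightGood ps)

⋆⋆-outcome : ∀ {γ} → AllSmall γ → o⁻ (⋆ + ⋆ + γ) ≡ o⁻ γ
⋆⋆-outcome pγ = cong₂ outcomeOf (⋆⋆-leftWinsFirst pγ) (⋆⋆-rightWinsFirst pγ)

theorem4p2p2 : (ξ : Game) → AllSmall ξ → ¬ ξ ≡ 𝟘 → (⋆ + ⋆) ≡ 𝟘 mod-cl ξ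
theorem4p2p2 ξ pξ _ γ γ∈cl = begin
  o⁻ (⋆ + ⋆ + γ)  ≡⟨ ⋆⋆-outcome (closure-allSmall pξ γ∈cl) ⟩
  o⁻ γ            ≡⟨ cong o⁻ (sym (𝟘-+-identity γ)) ⟩
  o⁻ (𝟘 + γ)      ∎
  where open ≡-Reasoning
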